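{- There are infinitely many triples $(a,b,c)$ of positive integers, each greater than $1$, such that $ab+1$, $ac+1$, $bc+1$ and $abc+1$ are all perfect squares. -}

module Defs where

open import Data.Nat using (ℕ; _*_; _<_)
open import Data.Product using (∃; _×_)
open import Relation.Binary.PropositionalEquality using (_≡_)

IsSquare : ℕ → Set
IsSquare n = ∃ λ m → m * m ≡ n

Good : ℕ → ℕ → ℕ → Set
Good a b c = 1 < a × 1 < b × 1 < c
           × IsSquare (a * b + 1) × IsSquare (a * c + 1)
           × IsSquare (b * c + 1) × IsSquare (a * b * c + 1)
  where open import Data.Nat using (_+_)

-- A pair {a, b} with a b + 1 = r² extends to the regular triple {a, b, a + b + 2r}, for which
-- a c + 1 = (a + r)² and b c + 1 = (b + r)².  Then a b c + 1 = (r² − 1) c + 1, and writing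
-- r = m + 1 this is the square (k (m + 2) + 1)² as soon as c m = k (k (m + 2) + 2).
-- An explicit polynomial family in (G, q) meets both conditions whenever
-- 2G² + 2Gq + 4G = q² + q + 6.  With u = 2G + q + 2 and p = q + 1 this conic is the Pell-type
-- equation u² − 3p² = 13, so multiplication by 2 + √3 gives infinitely many solutions, and
-- along them the triples grow without bound.
module Submission where

open import Defs
open import Data.Nat using (ℕ; zero; suc; _+_; _*_; _≤_; _<_; s≤s; z≤n)
open import Data.Nat.Properties using (+-cancelʳ-≡; m≤m+n; m≤n+m; ≤-trans; ≤-<-trans; <-≤-trans)
open import Data.Nat.Tactic.RingSolver using (solve-∀)
open import Data.Product using (∃; ∃₂; _×_; _,_; proj₁; proj₂)
open import Relation.Binary.PropositionalEquality
  using (_≡_; refl; sym; trans; cong; module ≡-Reasoning)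

+-cancel-≡-addends : ∀ {u v x y} → x ≡ y → u + x ≡ v + y → u ≡ v
+-cancel-≡-addends {u} {v} {x} {y} x≡y eq = +-cancelʳ-≡ y u v (trans (cong (u +_) (sym x≡y)) eq)

regular-extension : ∀ a b r → a * b + 1 ≡ r * r →
                    IsSquare (a * (a + b + 2 * r) + 1) × IsSquare (b * (a + b + 2 * r) + 1)
regular-extension a b r ab+1≡r² =
  (a + r , +-cancel-≡-addends ab+1≡r² (left a b r)) ,
  (b + r , +-cancel-≡-addends ab+1≡r² (right a b r))
  where
  left : ∀ a b r → (a + r) * (a + r) + (a * b + 1) ≡ a * (a + b + 2 * r) + 1 + r * r
  left = solve-∀
  right : ∀ a b r → (b + r) * (b + r) + (a * b + 1) ≡ b * (a + b + 2 * r) + 1 + r * r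
  right = solve-∀

product-square : ∀ a b c m k → a * b + 1 ≡ suc m * suc m → c * m ≡ k * (k * (m + 2) + 2) →
                 IsSquare (a * b * c + 1)
product-square a b c m k ab+1≡r² cm≡k[k[m+2]+2] = k * (m + 2) + 1 , (begin
  (k * (m + 2) + 1) * (k * (m + 2) + 1)  ≡⟨ expand m k ⟩
  (m + 2) * (k * (k * (m + 2) + 2)) + 1  ≡⟨ cong (λ z → (m + 2) * z + 1) (sym cm≡k[k[m+2]+2]) ⟩
  (m + 2) * (c * m) + 1                  ≡⟨ cong (_+ 1) (regroup m c) ⟩
  m * (m + 2) * c + 1                    ≡⟨ cong (λ z → z * c + 1) (sym ab≡m[m+2]) ⟩
  a * b * c + 1                          ∎)
  where
  open ≡-Reasoning
  expand : ∀ m k → (k * (m + 2) + 1) * (k * (m + 2) + 1) ≡ (m + 2) * (k * (k * (m + 2) + 2)) + 1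
  expand = solve-∀
  regroup : ∀ m c → (m + 2) * (c * m) ≡ m * (m + 2) * c
  regroup = solve-∀
  square-pred : ∀ m → suc m * suc m ≡ m * (m + 2) + 1
  square-pred = solve-∀
  ab≡m[m+2] : a * b ≡ m * (m + 2)
  ab≡m[m+2] = +-cancelʳ-≡ 1 (a * b) (m * (m + 2)) (trans ab+1≡r² (square-pred m))

-- The identities below hold only on the conic.  They are stated with the two sides of the conic
-- equation added crosswise, which makes them semiring identities; since the ring solver does not
-- unfold definitions, the family is spelled out in them.
Conic : ℕ → ℕ → Set
Conic G q = 2 * G * G + 2 * G * q + 4 * G ≡ q * q + q + 6

conic-step : ∀ G q → Conic G q → Conic (G + q + 1) (suc (q + 2 * (G + q + 1)))
conic-step G q on = +-cancel-≡-addends (sym on) (identity G q)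
  where
  identity : ∀ G q →
    2 * (G + q + 1) * (G + q + 1) + 2 * (G + q + 1) * suc (q + 2 * (G + q + 1)) + 4 * (G + q + 1)
      + (q * q + q + 6)
    ≡ suc (q + 2 * (G + q + 1)) * suc (q + 2 * (G + q + 1)) + suc (q + 2 * (G + q + 1)) + 6
      + (2 * G * G + 2 * G * q + 4 * G)
  identity = solve-∀

conic-unbounded : ∀ n → ∃₂ λ G q → Conic G q × n ≤ q
conic-unbounded zero = 1 , 0 , refl , z≤n
conic-unbounded (suc n) with conic-unbounded n
... | G , q , on , n≤q =
  G + q + 1 , suc (q + 2 * (G + q + 1)) , conic-step G q on , s≤s (≤-trans n≤q (m≤m+n q _))

module Family (G q : ℕ) where

  p : ℕ
  p = suc q

  a : ℕ
  a = 4 + p * p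

  b : ℕ
  b = 3 + (2 * q * p + p * p * p * p + 2 * G * q + 2 * G * (p * p * p) + G * G * (p * p))

  m : ℕ
  m = p * p * p + G * (p * p) + 2 * G + 3 * q + 1

  r : ℕ
  r = suc m

  c : ℕ
  c = a + b + 2 * r

  k : ℕ
  k = p * (G + q + 2) + 1

  module _ (on : Conic G q) where

    ab+1≡r² : a * b + 1 ≡ r * r
    ab+1≡r² = +-cancel-≡-addends (cong (2 *_) on) (identity G q)
      where
      identity : ∀ G q →
        (4 + suc q * suc q)
          * (3 + (2 * q * suc q + suc q * suc q * suc q * suc q + 2 * G * q
                  + 2 * G * (suc q * suc q * suc q) + G * G * (suc q * suc q)))
          + 1 + 2 * (2 * G * G + 2 * G * q + 4 * G)
        ≡ suc (suc q * suc q * suc q + G * (suc q * suc q) + 2 * G + 3 * q + 1)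
          * suc (suc q * suc q * suc q + G * (suc q * suc q) + 2 * G + 3 * q + 1)
          + 2 * (q * q + q + 6)
      identity = solve-∀

    cm≡k[k[m+2]+2] : c * m ≡ k * (k * (m + 2) + 2)
    cm≡k[k[m+2]+2] = +-cancel-≡-addends (cong (2 *_) (sym on)) (identity G q)
      where
      identity : ∀ G q →
        ((4 + suc q * suc q)
          + (3 + (2 * q * suc q + suc q * suc q * suc q * suc q + 2 * G * q
                  + 2 * G * (suc q * suc q * suc q) + G * G * (suc q * suc q)))
          + 2 * suc (suc q * suc q * suc q + G * (suc q * suc q) + 2 * G + 3 * q + 1))
          * (suc q * suc q * suc q + G * (suc q * suc q) + 2 * G + 3 * q + 1)
          + 2 * (q * q + q + 6)
        ≡ (suc q * (G + q + 2) + 1)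
          * ((suc q * (G + q + 2) + 1)
             * (suc q * suc q * suc q + G * (suc q * suc q) + 2 * G + 3 * q + 1 + 2) + 2)
          + 2 * (2 * G * G + 2 * G * q + 4 * G)
      identity = solve-∀

    good : Good a b c
    good = s≤s (s≤s z≤n) , s≤s (s≤s z≤n) , s≤s (s≤s z≤n) ,
           (r , sym ab+1≡r²) ,
           proj₁ (regular-extension a b r ab+1≡r²) ,
           proj₂ (regular-extension a b r ab+1≡r²) ,
           product-square a b c m k ab+1≡r² cm≡k[k[m+2]+2]

  q<a+b+c : q < a + b + c
  q<a+b+c = <-≤-trans (s≤s (≤-trans (m≤m+n q (q * p)) (m≤n+m _ 4)))
                     (≤-trans (m≤m+n a b) (m≤m+n (a + b) c))

theorem1 : (N : ℕ) → ∃ λ a → ∃ λ b → ∃ λ c → N < a + b + c × Good a b c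
theorem1 N with conic-unbounded N
... | G , q , on , N≤q = a , b , c , ≤-<-trans N≤q q<a+b+c , good on
  where open Family G q
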